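{- Let $d$ be a positive integer and let $w,v$ be type sequences each having $r$ occurrences of $+$ and $c$ occurrences of $-$. Say that a skew $d$-semistandard $w$-oscillating tableau $T$ and a skew $d$-semistandard $v$-oscillating tableau $P$ correspond if there is a skew $d$-RSK growth diagram on $\mathrm{Rect}_{(c,r)}$ in which $T$ is the sequence of $d$-staircases along the path $\mathcal{P}^w$ and $P$ is the sequence along $\mathcal{P}^v$. If $T$ and $P$ correspond, then: (i) $T$ and $P$ have the same inner shape and the same outer shape; (ii) $\mathrm{wt}^+(T)=\mathrm{wt}^+(P)$ and $\mathrm{wt}^-(T)=\mathrm{wt}^-(P)$; (iii) $\mathrm{MCW}_d(T)=\mathrm{MCW}_d(P)$; (iv) the reversals $T^{\mathrm{rev}}$ and $P^{\mathrm{rev}}$ (as sequences of $d$-staircases, viewed as oscillating tableaux for the type sequences obtained from $w$, $v$ by reversing and swapping $+$ with $-$) also correspond.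
   Context: A $d$-staircase is a sequence of integers $\lambda=(\lambda_1\ge\cdots\ge\lambda_d)$; $|\lambda|=\sum\lambda_i$. For $d$-staircases, $\alpha\prec\beta$ (or $\beta\succ\alpha$) means $\beta_1\ge\alpha_1\ge\cdots\ge\beta_d\ge\alpha_d$. For $w=w_1\cdots w_k$, a skew $d$-semistandard $w$-oscillating tableau of shape $\lambda/\mu$ is a sequence of $d$-staircases $\mu=\lambda^{(0)},\ldots,\lambda^{(k)}=\lambda$ with $\lambda^{(i-1)}\prec\lambda^{(i)}$ if $w_i=+$, $\lambda^{(i-1)}\succ\lambda^{(i)}$ if $w_i=-$; $\mu$ is the inner and $\lambda$ the outer shape. $\mathrm{wt}^+(T)_i=|\lambda^{(a_i)}|-|\lambda^{(a_i-1)}|$ with $a_i$ the index of the $i$th occurrence of $+$ in $w$; $\mathrm{wt}^-(T)_i=|\lambda^{(b_i-1)}|-|\lambda^{(b_i)}|$ with $b_i$ the index of the $i$th-to-last occurrence of $-$. For $\alpha\prec\beta$ set $\mathrm{MCW}_d(\alpha,\beta)=\beta_1-\alpha_d$, for $\alpha\succ\beta$ set $\mathrm{MCW}_d(\alpha,\beta)=\alpha_1-\beta_d$; $\mathrm{MCW}_d(T)=\max_i\mathrm{MCW}_d(\lambda^{(i-1)},\lambda^{(i)})$. $\mathrm{Rect}_{(a,b)}=[0,a]\times[0,b]$ with unit cells and integer lattice points; $\mathcal{P}^w$ is the lattice path from $(c,0)$ to $(0,r)$ whose unit steps are encoded by $w$ ($+$ up, $-$ left). A skew $d$-RSK growth diagram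 on $\mathrm{Rect}_{(c,r)}$ assigns a $d$-staircase to each lattice point (no boundary condition), with every cell (all entries $0$) with corners $\kappa$ (bottom-left), $\mu$ (top-left), $\nu$ (bottom-right), $\rho$ (top-right) satisfying $\mu\succ\kappa\prec\nu$, $\mu\prec\rho\succ\nu$, $\rho_1+\kappa_d=\min(\mu_d,\nu_d)+\max(\mu_1,\nu_1)$, $\rho_i+\kappa_{i-1}=\min(\mu_{i-1},\nu_{i-1})+\max(\mu_i,\nu_i)$ for $2\le i\le d$. It is known (proved in the paper) that any such tableau on $\mathcal{P}^w$ extends uniquely to such a growth diagram, so correspondence is a bijection. -}

module Defs where

open import Data.Nat as ℕ using (ℕ; zero; suc; _∸_; _<_)
open import Data.Integer as ℤ using (ℤ; _≤_; _+_; _-_; _⊔_; _⊓_; 0ℤ)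
open import Data.Fin using (Fin; inject₁; fromℕ)
import Data.Fin as F
open import Data.Vec using (Vec; lookup; foldr)
open import Data.List as L using (List; []; _∷_; map; reverse)
open import Data.Maybe using (Maybe; just; nothing)
open import Data.Product using (Σ; _×_; _,_; uncurry)
open import Data.Empty using (⊥)
open import Relation.Binary.PropositionalEquality using (_≡_)

-- Throughout, d = suc n (d positive); a d-staircase is a vector in ℤ^d,
-- index 0 = paper's index 1, index fromℕ n = paper's index d.
Vecℤ : ℕ → Set
Vecℤ n = Vec ℤ (suc n)

first : ∀ {n} → Vecℤ n → ℤ
first λ' = lookup λ' F.zero

lst : ∀ {n} → Vecℤ n → ℤ
lst {n} λ' = lookup λ' (fromℕ n)

IsStaircase : ∀ {n} → Vecℤ n → Set
IsStaircase {n} λ' = ∀ (i : Fin n) → lookup λ' (F.suc i) ≤ lookup λ' (inject₁ i)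

_≺_ : ∀ {n} → Vecℤ n → Vecℤ n → Set
_≺_ {n} α β = (∀ (i : Fin (suc n)) → lookup α i ≤ lookup β i)
            × (∀ (i : Fin n) → lookup β (F.suc i) ≤ lookup α (inject₁ i))

size : ∀ {n} → Vecℤ n → ℤ
size = foldr _ _+_ 0ℤ

data Sign : Set where
  ⊕ ⊖ : Sign

swap : Sign → Sign
swap ⊕ = ⊖
swap ⊖ = ⊕

revSwap : List Sign → List Sign
revSwap w = reverse (map swap w)

count⊕ : List Sign → ℕ
count⊕ [] = 0
count⊕ (⊕ ∷ w) = suc (count⊕ w)
count⊕ (⊖ ∷ w) = count⊕ w

count⊖ : List Sign → ℕ
count⊖ [] = 0
count⊖ (⊕ ∷ w) = count⊖ w
count⊖ (⊖ ∷ w) = suc (count⊖ w)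

Step : ∀ {n} → Sign → Vecℤ n → Vecℤ n → Set
Step ⊕ α β = α ≺ β
Step ⊖ α β = β ≺ α

Tableau : ℕ → Set
Tableau n = List (Vecℤ n)

Osc : ∀ {n} → List Sign → Tableau n → Set
Osc [] (λ' ∷ []) = IsStaircase λ'
Osc (s ∷ w) (λ' ∷ μ ∷ rest) = IsStaircase λ' × Step s λ' μ × Osc w (μ ∷ rest)
Osc _ _ = ⊥

innerShape : ∀ {n} → Tableau n → Maybe (Vecℤ n)
innerShape = L.head

outerShape : ∀ {n} → Tableau n → Maybe (Vecℤ n)
outerShape = L.last

wt⁺ : ∀ {n} → List Sign → Tableau n → List ℤ
wt⁺ (⊕ ∷ w) (λ' ∷ μ ∷ rest) = (size μ - size λ') ∷ wt⁺ w (μ ∷ rest)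
wt⁺ (⊖ ∷ w) (λ' ∷ μ ∷ rest) = wt⁺ w (μ ∷ rest)
wt⁺ _ _ = []

wt⁻fwd : ∀ {n} → List Sign → Tableau n → List ℤ
wt⁻fwd (⊕ ∷ w) (λ' ∷ μ ∷ rest) = wt⁻fwd w (μ ∷ rest)
wt⁻fwd (⊖ ∷ w) (λ' ∷ μ ∷ rest) = (size λ' - size μ) ∷ wt⁻fwd w (μ ∷ rest)
wt⁻fwd _ _ = []

wt⁻ : ∀ {n} → List Sign → Tableau n → List ℤ
wt⁻ w T = reverse (wt⁻fwd w T)

mcwSteps : ∀ {n} → List Sign → Tableau n → List ℤ
mcwSteps (⊕ ∷ w) (α ∷ β ∷ rest) = (first β - lst α) ∷ mcwSteps w (β ∷ rest)
mcwSteps (⊖ ∷ w) (α ∷ β ∷ rest) = (first α - lst β) ∷ mcwSteps w (β ∷ rest)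
mcwSteps _ _ = []

maxList : List ℤ → Maybe ℤ
maxList [] = nothing
maxList (x ∷ xs) with maxList xs
... | nothing = just x
... | just m = just (x ⊔ m)

MCW : ∀ {n} → List Sign → Tableau n → Maybe ℤ
MCW w T = maxList (mcwSteps w T)

-- local rule for a cell with corners κ (bottom-left), μ (top-left),
-- ν (bottom-right), ρ (top-right)
Cell : ∀ {n} → Vecℤ n → Vecℤ n → Vecℤ n → Vecℤ n → Set
Cell {n} κ μ ν ρ =
    (κ ≺ μ) × (κ ≺ ν) × (μ ≺ ρ) × (ν ≺ ρ)
  × (first ρ + lst κ ≡ (lst μ ⊓ lst ν) + (first μ ⊔ first ν))
  × (∀ (i : Fin n) →
       lookup ρ (F.suc i) + lookup κ (inject₁ i)
         ≡ (lookup μ (inject₁ i) ⊓ lookup ν (inject₁ i))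
           + (lookup μ (F.suc i) ⊔ lookup ν (F.suc i)))

-- skew d-RSK growth diagram on Rect_(c,r); g x y is the staircase at (x,y)
-- (values outside the rectangle are irrelevant)
GrowthDiagram : ∀ {n} → ℕ → ℕ → (ℕ → ℕ → Vecℤ n) → Set
GrowthDiagram c r g =
    (∀ x y → x ℕ.≤ c → y ℕ.≤ r → IsStaircase (g x y))
  × (∀ x y → x < c → y < r →
       Cell (g x y) (g x (suc y)) (g (suc x) y) (g (suc x) (suc y)))

pathFrom : ℕ → ℕ → List Sign → List (ℕ × ℕ)
pathFrom x y [] = (x , y) ∷ []
pathFrom x y (⊕ ∷ w) = (x , y) ∷ pathFrom x (suc y) w
pathFrom x y (⊖ ∷ w) = (x , y) ∷ pathFrom (x ∸ 1) y w

-- P^w goes from (c,0) to (0,r)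
path : ℕ → List Sign → List (ℕ × ℕ)
path c w = pathFrom c 0 w

Correspond : ∀ {n} → ℕ → ℕ → List Sign → List Sign → Tableau n → Tableau n → Set
Correspond {n} c r w v T P =
  Σ (ℕ → ℕ → Vecℤ n) λ g →
      GrowthDiagram c r g
    × (T ≡ map (uncurry g) (path c w))
    × (P ≡ map (uncurry g) (path c v))

-- Any two lattice paths from (c,0) to (0,r) are connected by flipping corners
-- (a left-then-up step pair into up-then-left) across single cells. Each
-- statistic of the theorem is unchanged by such a flip because of the local
-- rule of the cell: adding all its relations gives |ρ| + |κ| = |μ| + |ν|,
-- which keeps the sequence of weights, and the first relation says
-- max(μ₁,ν₁) − κ_d = ρ₁ − min(μ_d,ν_d), which keeps the maximum of the
-- MCW values. For the reversal, the local rule is symmetric in μ and ν, so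
-- the transposed diagram is again a growth diagram, and reversing a path
-- from (c,0) to (0,r) is the transposed path of the reversed, sign-swapped
-- word. The outer shape is then the inner shape of the reversal.

module Submission where

open import Defs
open import Data.Nat using (ℕ)
open import Data.List using (List; reverse)
open import Data.Product using (_×_)
open import Relation.Binary.PropositionalEquality using (_≡_)

open import Data.Nat as ℕ using (zero; suc; _<_; s≤s)
import Data.Nat.Properties as ℕ
open import Data.Integer using (ℤ; 0ℤ; _+_; _-_; _⊔_; _⊓_; -_)
open import Data.Integer.Properties
open import Data.Integer.Tactic.RingSolver using (solve-∀)
open import Algebra.Properties.CommutativeMonoid.Sum +-0-commutativeMonoid
  using (sum; ∑-distrib-+; sum-init-last; sum-cong-≗)
open import Data.Fin as Fin using (inject₁)
open import Data.Vec as Vec using (Vec; lookup)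
open import Data.Vec.Functional as Vector using (Vector; init; last)
open import Data.List as List using (_∷_; []; map; replicate; _++_; _∷ʳ_; head)
open import Data.List.Properties using (unfold-reverse; reverse-map; reverse-involutive; map-++; map-∘)
open import Data.Maybe using (just; nothing)
open import Data.Product as Product using (_,_; uncurry)
open import Data.Sum using (inj₁; inj₂)
open import Function using (id; flip)
open import Relation.Binary.PropositionalEquality
  using (refl; sym; trans; cong; cong₂; subst; subst₂; module ≡-Reasoning)

private
  variable
    n c r : ℕ

-- Cells of a growth diagram

i⊓j+i⊔j≡i+j : ∀ i j → (i ⊓ j) + (i ⊔ j) ≡ i + j
i⊓j+i⊔j≡i+j i j with ≤-total i j
... | inj₁ i≤j = cong₂ _+_ (i≤j⇒i⊓j≡i i≤j) (i≤j⇒i⊔j≡j i≤j)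
... | inj₂ j≤i = trans (cong₂ _+_ (i≥j⇒i⊓j≡j j≤i) (i≥j⇒i⊔j≡i j≤i)) (+-comm j i)

rotateʳ : ∀ {m} {A : Set} → Vector A (suc m) → Vector A (suc m)
rotateʳ f = last f Vector.∷ init f

sum-rotateʳ : ∀ {m} (f : Vector ℤ (suc m)) → sum (rotateʳ f) ≡ sum f
sum-rotateʳ f = trans (+-comm (last f) (sum (init f))) (sym (sum-init-last f))

foldr-+≡sum-lookup : ∀ {m} (v : Vec ℤ m) → Vec.foldr _ _+_ 0ℤ v ≡ sum (lookup v)
foldr-+≡sum-lookup Vec.[] = refl
foldr-+≡sum-lookup (x Vec.∷ v) = cong (x +_) (foldr-+≡sum-lookup v)

a+b≡c+d⇒d-b≡a-c : ∀ a b c d → a + b ≡ c + d → d - b ≡ a - c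
a+b≡c+d⇒d-b≡a-c a b c d eq = begin
  d - b             ≡⟨ shift b c d ⟩
  (c + d) - (b + c) ≡⟨ cong (_- (b + c)) (sym eq) ⟩
  (a + b) - (b + c) ≡⟨ cancel a b c ⟩
  a - c             ∎
  where
  open ≡-Reasoning
  shift : ∀ b c d → d - b ≡ (c + d) - (b + c)
  shift = solve-∀
  cancel : ∀ a b c → (a + b) - (b + c) ≡ a - c
  cancel = solve-∀

module _ (κ μ ν ρ : Vecℤ n) (cell : Cell κ μ ν ρ) where

  private
    mins maxs : Vector ℤ (suc n)
    mins i = lookup μ i ⊓ lookup ν i
    maxs i = lookup μ i ⊔ lookup ν i

    rule₁ : first ρ + lst κ ≡ (lst μ ⊓ lst ν) + (first μ ⊔ first ν)
    rule₁ = let (_ , _ , _ , _ , e , _) = cell in e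

    -- The local rule pairs ρ_j with κ_(j−1) and min_(j−1) with max_j, indices read cyclically.
    rule-rotated : ∀ j → lookup ρ j + rotateʳ (lookup κ) j ≡ rotateʳ mins j + maxs j
    rule-rotated Fin.zero = rule₁
    rule-rotated (Fin.suc i) = let (_ , _ , _ , _ , _ , e) = cell in e i

  Cell-size : size ρ + size κ ≡ size μ + size ν
  Cell-size = begin
    size ρ + size κ
      ≡⟨ cong₂ _+_ (foldr-+≡sum-lookup ρ) (trans (foldr-+≡sum-lookup κ) (sym (sum-rotateʳ (lookup κ)))) ⟩
    sum (lookup ρ) + sum (rotateʳ (lookup κ))
      ≡⟨ sym (∑-distrib-+ (lookup ρ) (rotateʳ (lookup κ))) ⟩
    sum (λ j → lookup ρ j + rotateʳ (lookup κ) j)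
      ≡⟨ sum-cong-≗ rule-rotated ⟩
    sum (λ j → rotateʳ mins j + maxs j)
      ≡⟨ ∑-distrib-+ (rotateʳ mins) maxs ⟩
    sum (rotateʳ mins) + sum maxs
      ≡⟨ cong (_+ sum maxs) (sum-rotateʳ mins) ⟩
    sum mins + sum maxs
      ≡⟨ sym (∑-distrib-+ mins maxs) ⟩
    sum (λ i → mins i + maxs i)
      ≡⟨ sum-cong-≗ (λ i → i⊓j+i⊔j≡i+j (lookup μ i) (lookup ν i)) ⟩
    sum (λ i → lookup μ i + lookup ν i)
      ≡⟨ ∑-distrib-+ (lookup μ) (lookup ν) ⟩
    sum (lookup μ) + sum (lookup ν)
      ≡⟨ sym (cong₂ _+_ (foldr-+≡sum-lookup μ) (foldr-+≡sum-lookup ν)) ⟩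
    size μ + size ν ∎
    where open ≡-Reasoning

  Cell-size-increment : size μ - size κ ≡ size ρ - size ν
  Cell-size-increment = a+b≡c+d⇒d-b≡a-c (size ρ) (size κ) (size ν) (size μ) (trans Cell-size (+-comm (size μ) (size ν)))

  Cell-MCW : (first ν - lst κ) ⊔ (first μ - lst κ) ≡ (first ρ - lst ν) ⊔ (first ρ - lst μ)
  Cell-MCW = begin
    (first ν - lst κ) ⊔ (first μ - lst κ)
      ≡⟨ sym (mono-≤-distrib-⊔ (+-monoˡ-≤ (- lst κ)) (first ν) (first μ)) ⟩
    (first ν ⊔ first μ) - lst κ
      ≡⟨ cong (_- lst κ) (⊔-comm (first ν) (first μ)) ⟩
    (first μ ⊔ first ν) - lst κ
      ≡⟨ a+b≡c+d⇒d-b≡a-c (first ρ) (lst κ) (lst μ ⊓ lst ν) (first μ ⊔ first ν) rule₁ ⟩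
    first ρ - (lst μ ⊓ lst ν)
      ≡⟨ cong (λ m → first ρ - m) (⊓-comm (lst μ) (lst ν)) ⟩
    first ρ - (lst ν ⊓ lst μ)
      ≡⟨ antimono-≤-distrib-⊓ (λ p → +-monoʳ-≤ (first ρ) (neg-mono-≤ p)) (lst ν) (lst μ) ⟩
    (first ρ - lst ν) ⊔ (first ρ - lst μ) ∎
    where open ≡-Reasoning

Cell-transpose : ∀ (κ μ ν ρ : Vecℤ n) → Cell κ μ ν ρ → Cell κ ν μ ρ
Cell-transpose _ μ ν _ (κ≺μ , κ≺ν , μ≺ρ , ν≺ρ , rule₁ , rule) =
    κ≺ν , κ≺μ , ν≺ρ , μ≺ρ
  , trans rule₁ (cong₂ _+_ (⊓-comm (lst μ) (lst ν)) (⊔-comm (first μ) (first ν)))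
  , λ i → trans (rule i) (cong₂ _+_ (⊓-comm (lookup μ (inject₁ i)) (lookup ν (inject₁ i)))
                                    (⊔-comm (lookup μ (Fin.suc i)) (lookup ν (Fin.suc i))))

LocalRules : ℕ → ℕ → (ℕ → ℕ → Vecℤ n) → Set
LocalRules c r g =
  ∀ x y → x < c → y < r → Cell (g x y) (g x (suc y)) (g (suc x) y) (g (suc x) (suc y))

GrowthDiagram-transpose : ∀ {g : ℕ → ℕ → Vecℤ n} → GrowthDiagram c r g → GrowthDiagram r c (flip g)
GrowthDiagram-transpose {g = g} (staircases , cells) =
    (λ x y x≤r y≤c → staircases y x y≤c x≤r)
  , (λ x y x<r y<c → Cell-transpose (g y x) (g y (suc x)) (g (suc y) x) (g (suc y) (suc x)) (cells y x y<c x<r))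

-- Statistics invariant under flipping a corner of a lattice path

maxList-∷-cong : ∀ a {xs ys} → maxList xs ≡ maxList ys → maxList (a ∷ xs) ≡ maxList (a ∷ ys)
maxList-∷-cong a {xs} {ys} eq with maxList xs | maxList ys | eq
... | nothing | _ | refl = refl
... | just _  | _ | refl = refl

maxList-∷-∷ : ∀ {a b a′ b′} xs → a ⊔ b ≡ a′ ⊔ b′ → maxList (a ∷ b ∷ xs) ≡ maxList (a′ ∷ b′ ∷ xs)
maxList-∷-∷ {a} {b} {a′} {b′} xs eq with maxList xs
... | nothing = cong just eq
... | just m  = cong just (trans (sym (⊔-assoc a b m)) (trans (cong (_⊔ m) eq) (⊔-assoc a′ b′ m)))

-- stat x y u is a statistic of the path u started at the lattice point (x, y).
record FlipInvariant {B : Set} (c r : ℕ) (stat : ℕ → ℕ → List Sign → B) : Set where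
  field
    ⊕-cong : ∀ {x y u u′} → stat x (suc y) u ≡ stat x (suc y) u′ → stat x y (⊕ ∷ u) ≡ stat x y (⊕ ∷ u′)
    ⊖-cong : ∀ {x y u u′} → stat x y u ≡ stat x y u′ → stat (suc x) y (⊖ ∷ u) ≡ stat (suc x) y (⊖ ∷ u′)
    flip-corner : ∀ {x y} u → x < c → y < r → stat (suc x) y (⊖ ∷ ⊕ ∷ u) ≡ stat (suc x) y (⊕ ∷ ⊖ ∷ u)

upThenLeft : ℕ → ℕ → List Sign
upThenLeft a b = replicate a ⊕ ++ replicate b ⊖

Traverses : ℕ → ℕ → List Sign → Set
Traverses c r u = count⊕ u ≡ r × count⊖ u ≡ c

module _ {B : Set} {stat : ℕ → ℕ → List Sign → B} (S : FlipInvariant c r stat) where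
  open FlipInvariant S

  private
    +-suc-≤ : ∀ y a → y ℕ.+ suc a ℕ.≤ r → suc y ℕ.+ a ℕ.≤ r
    +-suc-≤ y a = subst (ℕ._≤ r) (ℕ.+-suc y a)

  ⊖∷upThenLeft : ∀ a b {x y} → x < c → y ℕ.+ a ℕ.≤ r →
             stat (suc x) y (⊖ ∷ upThenLeft a b) ≡ stat (suc x) y (upThenLeft a (suc b))
  ⊖∷upThenLeft zero    b x<c y+a≤r = refl
  ⊖∷upThenLeft (suc a) b {x} {y} x<c y+a≤r = trans
    (flip-corner (upThenLeft a b) x<c (ℕ.<-≤-trans (s≤s (ℕ.m≤m+n y a)) (+-suc-≤ y a y+a≤r)))
    (⊕-cong (⊖∷upThenLeft a b x<c (+-suc-≤ y a y+a≤r)))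

  stat-upThenLeft : ∀ u {x y} → count⊖ u ℕ.≤ x → x ℕ.≤ c → y ℕ.+ count⊕ u ℕ.≤ r →
                stat x y u ≡ stat x y (upThenLeft (count⊕ u) (count⊖ u))
  stat-upThenLeft []      _ _ _ = refl
  stat-upThenLeft (⊕ ∷ u) {y = y} k≤x x≤c y+p≤r =
    ⊕-cong (stat-upThenLeft u k≤x x≤c (+-suc-≤ y (count⊕ u) y+p≤r))
  stat-upThenLeft (⊖ ∷ u) {suc x} (s≤s k≤x) x<c y+p≤r = trans
    (⊖-cong (stat-upThenLeft u k≤x (ℕ.<⇒≤ x<c) y+p≤r))
    (⊖∷upThenLeft (count⊕ u) (count⊖ u) x<c y+p≤r)

  stat-pathIndependent : ∀ {u u′} → Traverses c r u → Traverses c r u′ → stat c 0 u ≡ stat c 0 u′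
  stat-pathIndependent {u} {u′} tu tu′ = trans (toUpLeft u tu) (sym (toUpLeft u′ tu′))
    where
    toUpLeft : ∀ u → Traverses c r u → stat c 0 u ≡ stat c 0 (upThenLeft r c)
    toUpLeft u (u⊕ , u⊖) = trans
      (stat-upThenLeft u (ℕ.≤-reflexive u⊖) ℕ.≤-refl (ℕ.≤-reflexive u⊕))
      (cong₂ (λ a b → stat c 0 (upThenLeft a b)) u⊕ u⊖)

-- Reading a growth diagram along a path

module _ (g : ℕ → ℕ → Vecℤ n) where

  -- map (uncurry g) (pathFrom x y u), but headed by g x y for every u, so that
  -- the statistics of Defs reduce on it.
  mutual
    along : ℕ → ℕ → List Sign → Tableau n
    along x y u = g x y ∷ beyond x y u

    beyond : ℕ → ℕ → List Sign → Tableau n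
    beyond x y []      = []
    beyond x y (⊕ ∷ u) = along x (suc y) u
    beyond x y (⊖ ∷ u) = along (x ℕ.∸ 1) y u

  map-pathFrom : ∀ x y u → map (uncurry g) (pathFrom x y u) ≡ along x y u
  map-pathFrom x y []      = refl
  map-pathFrom x y (⊕ ∷ u) = cong (g x y ∷_) (map-pathFrom x (suc y) u)
  map-pathFrom x y (⊖ ∷ u) = cong (g x y ∷_) (map-pathFrom (x ℕ.∸ 1) y u)

module _ {g : ℕ → ℕ → Vecℤ n} where

  innerShape-flipInvariant : FlipInvariant c r (λ x y u → innerShape (along g x y u))
  innerShape-flipInvariant = record
    { ⊕-cong = λ _ → refl ; ⊖-cong = λ _ → refl ; flip-corner = λ _ _ _ → refl }

  module _ (cells : LocalRules c r g) where

    wt⁺-flipInvariant : FlipInvariant c r (λ x y u → wt⁺ u (along g x y u))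
    wt⁺-flipInvariant = record
      { ⊕-cong = cong (_ ∷_)
      ; ⊖-cong = id
      ; flip-corner = λ {x} {y} u x<c y<r → cong (_∷ wt⁺ u (along g x (suc y) u))
          (Cell-size-increment (g x y) (g x (suc y)) (g (suc x) y) (g (suc x) (suc y))
            (cells x y x<c y<r))
      }

    wt⁻fwd-flipInvariant : FlipInvariant c r (λ x y u → wt⁻fwd u (along g x y u))
    wt⁻fwd-flipInvariant = record
      { ⊕-cong = id
      ; ⊖-cong = cong (_ ∷_)
      ; flip-corner = λ {x} {y} u x<c y<r → cong (_∷ wt⁻fwd u (along g x (suc y) u))
          (Cell-size-increment (g x y) (g (suc x) y) (g x (suc y)) (g (suc x) (suc y))
            (Cell-transpose (g x y) (g x (suc y)) (g (suc x) y) (g (suc x) (suc y))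
              (cells x y x<c y<r)))
      }

    MCW-flipInvariant : FlipInvariant c r (λ x y u → MCW u (along g x y u))
    MCW-flipInvariant = record
      { ⊕-cong = λ {x} {y} {u} {u′} →
          maxList-∷-cong _ {mcwSteps u (along g x (suc y) u)} {mcwSteps u′ (along g x (suc y) u′)}
      ; ⊖-cong = λ {x} {y} {u} {u′} →
          maxList-∷-cong _ {mcwSteps u (along g x y u)} {mcwSteps u′ (along g x y u′)}
      ; flip-corner = λ {x} {y} u x<c y<r → maxList-∷-∷ (mcwSteps u (along g x (suc y) u))
          (Cell-MCW (g x y) (g x (suc y)) (g (suc x) y) (g (suc x) (suc y)) (cells x y x<c y<r))
      }

Correspond-preserves : ∀ {B : Set} {w v} {T P : Tableau n} (F : List Sign → Tableau n → B) →
  (∀ {g} → LocalRules c r g → FlipInvariant c r (λ x y u → F u (along g x y u))) →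
  Traverses c r w → Traverses c r v → Correspond c r w v T P → F w T ≡ F v P
Correspond-preserves {c = c} {w = w} {v} F invariant tw tv (g , (_ , cells) , refl , refl) = begin
  F w (map (uncurry g) (path c w)) ≡⟨ cong (F w) (map-pathFrom g c 0 w) ⟩
  F w (along g c 0 w)              ≡⟨ stat-pathIndependent (invariant cells) tw tv ⟩
  F v (along g c 0 v)              ≡⟨ cong (F v) (map-pathFrom g c 0 v) ⟨
  F v (map (uncurry g) (path c v)) ∎
  where open ≡-Reasoning

-- Reversal

revSwap-∷ : ∀ s u → revSwap (s ∷ u) ≡ revSwap u ∷ʳ swap s
revSwap-∷ s u = unfold-reverse (swap s) (map swap u)

count⊕-∷ʳ : ∀ u s → count⊕ (u ∷ʳ s) ≡ count⊕ u ℕ.+ count⊕ (s ∷ [])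
count⊕-∷ʳ []      s = refl
count⊕-∷ʳ (⊕ ∷ u) s = cong suc (count⊕-∷ʳ u s)
count⊕-∷ʳ (⊖ ∷ u) s = count⊕-∷ʳ u s

count⊖-∷ʳ : ∀ u s → count⊖ (u ∷ʳ s) ≡ count⊖ u ℕ.+ count⊖ (s ∷ [])
count⊖-∷ʳ []      s = refl
count⊖-∷ʳ (⊕ ∷ u) s = count⊖-∷ʳ u s
count⊖-∷ʳ (⊖ ∷ u) s = cong suc (count⊖-∷ʳ u s)

count⊕-revSwap : ∀ u → count⊕ (revSwap u) ≡ count⊖ u
count⊕-revSwap []      = refl
count⊕-revSwap (⊕ ∷ u) rewrite revSwap-∷ ⊕ u | count⊕-∷ʳ (revSwap u) ⊖ =
  trans (ℕ.+-identityʳ _) (count⊕-revSwap u)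
count⊕-revSwap (⊖ ∷ u) rewrite revSwap-∷ ⊖ u | count⊕-∷ʳ (revSwap u) ⊕ =
  trans (ℕ.+-comm _ 1) (cong suc (count⊕-revSwap u))

count⊖-revSwap : ∀ u → count⊖ (revSwap u) ≡ count⊕ u
count⊖-revSwap []      = refl
count⊖-revSwap (⊕ ∷ u) rewrite revSwap-∷ ⊕ u | count⊖-∷ʳ (revSwap u) ⊖ =
  trans (ℕ.+-comm _ 1) (cong suc (count⊖-revSwap u))
count⊖-revSwap (⊖ ∷ u) rewrite revSwap-∷ ⊖ u | count⊖-∷ʳ (revSwap u) ⊕ =
  trans (ℕ.+-identityʳ _) (count⊖-revSwap u)

Traverses-revSwap : ∀ u → Traverses c r u → Traverses r c (revSwap u)
Traverses-revSwap u (u⊕ , u⊖) = trans (count⊕-revSwap u) u⊖ , trans (count⊖-revSwap u) u⊕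

move : Sign → ℕ × ℕ → ℕ × ℕ
move ⊕ (x , y) = x , suc y
move ⊖ (x , y) = x ℕ.∸ 1 , y

-- Starting at (count⊖ u + x, y), the path u ends at (x, count⊕ u + y); stated
-- this way so that the truncated subtraction in pathFrom never truncates.
pathFrom-∷ʳ : ∀ u s x y →
  pathFrom (count⊖ u ℕ.+ x) y (u ∷ʳ s) ≡ pathFrom (count⊖ u ℕ.+ x) y u ∷ʳ move s (x , count⊕ u ℕ.+ y)
pathFrom-∷ʳ []      ⊕ x y = refl
pathFrom-∷ʳ []      ⊖ x y = refl
pathFrom-∷ʳ (⊕ ∷ u) s x y = cong (_ ∷_) (trans (pathFrom-∷ʳ u s x (suc y))
  (cong (λ z → pathFrom (count⊖ u ℕ.+ x) (suc y) u ∷ʳ move s (x , z)) (ℕ.+-suc (count⊕ u) y)))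
pathFrom-∷ʳ (⊖ ∷ u) s x y = cong (_ ∷_) (pathFrom-∷ʳ u s x y)

pathFrom-revSwap-∷ʳ : ∀ u s x y →
  pathFrom (count⊕ u ℕ.+ x) y (revSwap u ∷ʳ s)
    ≡ pathFrom (count⊕ u ℕ.+ x) y (revSwap u) ∷ʳ move s (x , count⊖ u ℕ.+ y)
pathFrom-revSwap-∷ʳ u s x y =
  subst₂ (λ k p → pathFrom (k ℕ.+ x) y (revSwap u ∷ʳ s) ≡ pathFrom (k ℕ.+ x) y (revSwap u) ∷ʳ move s (x , p ℕ.+ y))
    (count⊖-revSwap u) (count⊕-revSwap u) (pathFrom-∷ʳ (revSwap u) s x y)

reverse-pathFrom : ∀ u x y →
  reverse (pathFrom (count⊖ u ℕ.+ x) y u) ≡ map Product.swap (pathFrom (count⊕ u ℕ.+ y) x (revSwap u))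
reverse-pathFrom []      x y = refl
reverse-pathFrom (⊕ ∷ u) x y = begin
  reverse ((k ℕ.+ x , y) ∷ pathFrom (k ℕ.+ x) (suc y) u)
    ≡⟨ unfold-reverse _ (pathFrom (k ℕ.+ x) (suc y) u) ⟩
  reverse (pathFrom (k ℕ.+ x) (suc y) u) ∷ʳ (k ℕ.+ x , y)
    ≡⟨ cong (_∷ʳ (k ℕ.+ x , y)) (reverse-pathFrom u x (suc y)) ⟩
  map Product.swap (pathFrom (p ℕ.+ suc y) x (revSwap u)) ∷ʳ (k ℕ.+ x , y)
    ≡⟨ map-++ Product.swap (pathFrom (p ℕ.+ suc y) x (revSwap u)) _ ⟨
  map Product.swap (pathFrom (p ℕ.+ suc y) x (revSwap u) ∷ʳ (y , k ℕ.+ x))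
    ≡⟨ cong (map Product.swap) (pathFrom-revSwap-∷ʳ u ⊖ (suc y) x) ⟨
  map Product.swap (pathFrom (p ℕ.+ suc y) x (revSwap u ∷ʳ ⊖))
    ≡⟨ cong₂ (λ a u′ → map Product.swap (pathFrom a x u′)) (ℕ.+-suc p y) (sym (revSwap-∷ ⊕ u)) ⟩
  map Product.swap (pathFrom (suc p ℕ.+ y) x (revSwap (⊕ ∷ u))) ∎
  where
  open ≡-Reasoning
  k = count⊖ u
  p = count⊕ u
reverse-pathFrom (⊖ ∷ u) x y = begin
  reverse ((suc k ℕ.+ x , y) ∷ pathFrom (k ℕ.+ x) y u)
    ≡⟨ unfold-reverse _ (pathFrom (k ℕ.+ x) y u) ⟩
  reverse (pathFrom (k ℕ.+ x) y u) ∷ʳ (suc k ℕ.+ x , y)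
    ≡⟨ cong (_∷ʳ (suc k ℕ.+ x , y)) (reverse-pathFrom u x y) ⟩
  map Product.swap (pathFrom (p ℕ.+ y) x (revSwap u)) ∷ʳ (suc k ℕ.+ x , y)
    ≡⟨ map-++ Product.swap (pathFrom (p ℕ.+ y) x (revSwap u)) _ ⟨
  map Product.swap (pathFrom (p ℕ.+ y) x (revSwap u) ∷ʳ (y , suc k ℕ.+ x))
    ≡⟨ cong (map Product.swap) (pathFrom-revSwap-∷ʳ u ⊕ y x) ⟨
  map Product.swap (pathFrom (p ℕ.+ y) x (revSwap u ∷ʳ ⊕))
    ≡⟨ cong (λ u′ → map Product.swap (pathFrom (p ℕ.+ y) x u′)) (sym (revSwap-∷ ⊖ u)) ⟩
  map Product.swap (pathFrom (p ℕ.+ y) x (revSwap (⊖ ∷ u))) ∎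
  where
  open ≡-Reasoning
  k = count⊖ u
  p = count⊕ u

reverse-readOff : ∀ (g : ℕ → ℕ → Vecℤ n) u → Traverses c r u →
  reverse (map (uncurry g) (path c u)) ≡ map (uncurry (flip g)) (path r (revSwap u))
reverse-readOff g u (refl , refl) = begin
  reverse (map (uncurry g) (pathFrom (count⊖ u) 0 u))
    ≡⟨ reverse-map (uncurry g) (pathFrom (count⊖ u) 0 u) ⟨
  map (uncurry g) (reverse (pathFrom (count⊖ u) 0 u))
    ≡⟨ cong (map (uncurry g)) reverse-path ⟩
  map (uncurry g) (map Product.swap (pathFrom (count⊕ u) 0 (revSwap u)))
    ≡⟨ map-∘ (pathFrom (count⊕ u) 0 (revSwap u)) ⟨
  map (uncurry (flip g)) (pathFrom (count⊕ u) 0 (revSwap u)) ∎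
  where
  open ≡-Reasoning
  reverse-path : reverse (pathFrom (count⊖ u) 0 u) ≡ map Product.swap (pathFrom (count⊕ u) 0 (revSwap u))
  reverse-path = subst₂ (λ a b → reverse (pathFrom a 0 u) ≡ map Product.swap (pathFrom b 0 (revSwap u)))
    (ℕ.+-identityʳ _) (ℕ.+-identityʳ _) (reverse-pathFrom u 0 0)

Correspond-reverse : ∀ {w v} {T P : Tableau n} → Traverses c r w → Traverses c r v →
  Correspond c r w v T P → Correspond r c (revSwap w) (revSwap v) (reverse T) (reverse P)
Correspond-reverse {w = w} {v} tw tv (g , diagram , refl , refl) =
  flip g , GrowthDiagram-transpose {g = g} diagram , reverse-readOff g w tw , reverse-readOff g v tv

Step-swap : ∀ s {α β : Vecℤ n} → Step s α β → Step (swap s) β α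
Step-swap ⊕ step = step
Step-swap ⊖ step = step

Osc-∷ʳ : ∀ {u} {T : Tableau n} {μ λ′} s →
  Osc u (T ∷ʳ μ) → Step s μ λ′ → IsStaircase λ′ → Osc (u ∷ʳ s) (T ∷ʳ μ ∷ʳ λ′)
Osc-∷ʳ {u = []}    {[]}            s μ-staircase step λ-staircase = μ-staircase , step , λ-staircase
Osc-∷ʳ {u = []}    {_ ∷ []}        s ()
Osc-∷ʳ {u = []}    {_ ∷ _ ∷ _}     s ()
Osc-∷ʳ {u = _ ∷ _} {[]}            s ()
Osc-∷ʳ {u = _ ∷ u} {_ ∷ []}        s (ρ-staircase , step′ , osc) step λ-staircase =
  ρ-staircase , step′ , Osc-∷ʳ {u = u} {[]} s osc step λ-staircase
Osc-∷ʳ {u = _ ∷ u} {_ ∷ ρ′ ∷ T}    s (ρ-staircase , step′ , osc) step λ-staircase =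
  ρ-staircase , step′ , Osc-∷ʳ {u = u} {ρ′ ∷ T} s osc step λ-staircase

Osc-reverse : ∀ w (T : Tableau n) → Osc w T → Osc (revSwap w) (reverse T)
Osc-reverse []      (_ ∷ [])          osc = osc
Osc-reverse []      []                ()
Osc-reverse []      (_ ∷ _ ∷ _)       ()
Osc-reverse (_ ∷ _) []                ()
Osc-reverse (_ ∷ _) (_ ∷ [])          ()
Osc-reverse (s ∷ w) (λ′ ∷ μ ∷ T) (λ-staircase , step , osc) =
  subst₂ Osc (sym (revSwap-∷ s w)) (sym reverse-λμT)
    (Osc-∷ʳ (swap s) (subst (Osc (revSwap w)) (unfold-reverse μ T) (Osc-reverse w (μ ∷ T) osc))
      (Step-swap s step) λ-staircase)
  where
  reverse-λμT : reverse (λ′ ∷ μ ∷ T) ≡ reverse T ∷ʳ μ ∷ʳ λ′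
  reverse-λμT = trans (unfold-reverse λ′ (μ ∷ T)) (cong (_∷ʳ λ′) (unfold-reverse μ T))

last-∷ʳ : ∀ {A : Set} (xs : List A) x → List.last (xs ∷ʳ x) ≡ just x
last-∷ʳ []           x = refl
last-∷ʳ (_ ∷ [])     x = refl
last-∷ʳ (_ ∷ y ∷ xs) x = last-∷ʳ (y ∷ xs) x

outerShape≡innerShape∘reverse : ∀ (T : Tableau n) → outerShape T ≡ innerShape (reverse T)
outerShape≡innerShape∘reverse T = begin
  List.last T                     ≡⟨ cong List.last (reverse-involutive T) ⟨
  List.last (reverse (reverse T)) ≡⟨ last-reverse (reverse T) ⟩
  head (reverse T)                ∎
  where
  open ≡-Reasoning
  last-reverse : ∀ xs → List.last (reverse xs) ≡ head xs
  last-reverse []       = refl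
  last-reverse (x ∷ xs) = trans (cong List.last (unfold-reverse x xs)) (last-∷ʳ (reverse xs) x)

Correspond-innerShape : ∀ {w v} {T P : Tableau n} → Traverses c r w → Traverses c r v →
  Correspond c r w v T P → innerShape T ≡ innerShape P
Correspond-innerShape = Correspond-preserves (λ _ → innerShape) (λ _ → innerShape-flipInvariant)

theorem7p2 : (n : ℕ) (r c : ℕ) (w v : List Sign)
    → count⊕ w ≡ r → count⊖ w ≡ c → count⊕ v ≡ r → count⊖ v ≡ c
    → (T P : Tableau n) → Osc w T → Osc v P
    → Correspond c r w v T P
    → ((innerShape T ≡ innerShape P) × (outerShape T ≡ outerShape P))
      × ((wt⁺ w T ≡ wt⁺ v P) × (wt⁻ w T ≡ wt⁻ v P))
      × (MCW w T ≡ MCW v P)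
      × (Osc (revSwap w) (reverse T) × Osc (revSwap v) (reverse P)
         × Correspond r c (revSwap w) (revSwap v) (reverse T) (reverse P))
theorem7p2 n r c w v w⊕ w⊖ v⊕ v⊖ T P oscT oscP corr =
    (Correspond-innerShape tw tv corr , outerShapes)
  , (Correspond-preserves wt⁺ wt⁺-flipInvariant tw tv corr
  , cong reverse (Correspond-preserves wt⁻fwd wt⁻fwd-flipInvariant tw tv corr))
  , Correspond-preserves MCW MCW-flipInvariant tw tv corr
  , Osc-reverse w T oscT , Osc-reverse v P oscP , corr-reversed
  where
  tw : Traverses c r w
  tw = w⊕ , w⊖
  tv : Traverses c r v
  tv = v⊕ , v⊖
  corr-reversed : Correspond r c (revSwap w) (revSwap v) (reverse T) (reverse P)
  corr-reversed = Correspond-reverse tw tv corr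
  outerShapes : outerShape T ≡ outerShape P
  outerShapes = begin
    outerShape T           ≡⟨ outerShape≡innerShape∘reverse T ⟩
    innerShape (reverse T) ≡⟨ Correspond-innerShape (Traverses-revSwap w tw) (Traverses-revSwap v tv) corr-reversed ⟩
    innerShape (reverse P) ≡⟨ outerShape≡innerShape∘reverse P ⟨
    outerShape P           ∎
    where open ≡-Reasoning
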